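{- Let $\ell\ge1$ be a fixed integer. Then ${\rm forb}\big(m,3,(\mathcal{T}_{\ell}(3)\setminus \mathcal{T}_{\ell}(2))\cup\{[0\ 1]\}\big)=\Theta(1)$ as $m\to\infty$, where $[0\ 1]$ is the $1\times 2$ matrix.
   Context: An $r$-matrix is a matrix with entries in $\{0,1,\ldots,r-1\}$. A matrix is simple if it has no repeated columns. For matrices $G,A$ write $G\prec A$ if some submatrix of $A$ is a row and column permutation of $G$. For a finite family $\mathcal F$ of matrices, ${\rm forb}(m,r,\mathcal F)$ is the maximum number of columns of an $m$-rowed simple $r$-matrix $A$ with $G\not\prec A$ for all $G\in\mathcal F$. For distinct symbols $x,y$, $I_\ell(x,y)$ is the $\ell\times\ell$ matrix with $x$'s on the diagonal and $y$'s elsewhere, and $T_\ell(x,y)$ is the $\ell\times\ell$ matrix with $x$'s strictly below the diagonal and $y$'s on and above the diagonal. $\mathcal T_\ell(r)=\{I_\ell(x,y),\,T_\ell(x,y): x,y\in\{0,\ldots,r-1\},\,x\neq y\}$. -}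

module Defs where

open import Data.Nat using (ℕ; zero; suc; _≤_; _<_)
open import Data.Fin using (Fin; toℕ; inject₁; _≟_) renaming (zero to f0; suc to fs)
open import Data.Fin.Properties using ()
open import Data.Product using (Σ; ∃; _×_; _,_)
open import Data.Sum using (_⊎_)
open import Function.Definitions using (Injective)
open import Relation.Binary.PropositionalEquality using (_≡_; _≢_)
open import Relation.Nullary using (¬_; Dec; yes; no)
import Data.Nat as N

Mat : ℕ → ℕ → ℕ → Set
Mat r k n = Fin k → Fin n → Fin r

Simple : ∀ {r m n} → Mat r m n → Set
Simple {m = m} {n = n} A = ∀ (j j' : Fin n) → (∀ (i : Fin m) → A i j ≡ A i j') → j ≡ j'

-- G ≺ A : some submatrix of A is a row and column permutation of G,
-- i.e. there are injective row/column maps sending G's entries to A's.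
_≺_ : ∀ {r k l m n} → Mat r k l → Mat r m n → Set
_≺_ {k = k} {l = l} {m = m} {n = n} G A =
  Σ (Fin k → Fin m) λ σ → Σ (Fin l → Fin n) λ τ →
    Injective _≡_ _≡_ σ × Injective _≡_ _≡_ τ ×
    (∀ i j → G i j ≡ A (σ i) (τ j))

Family : ℕ → Set₁
Family r = (k l : ℕ) → Mat r k l → Set

Avoids : ∀ {r m n} → Family r → Mat r m n → Set
Avoids {r} F A = ∀ (k l : ℕ) (G : Mat r k l) → F k l G → ¬ (G ≺ A)

_≐_ : ∀ {r k l} → Mat r k l → Mat r k l → Set
G ≐ H = ∀ i j → G i j ≡ H i j

Imat : ∀ {r} (ℓ : ℕ) → Fin r → Fin r → Mat r ℓ ℓ
Imat ℓ x y i j with i ≟ j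
... | yes _ = x
... | no  _ = y

Tmat : ∀ {r} (ℓ : ℕ) → Fin r → Fin r → Mat r ℓ ℓ
Tmat ℓ x y i j with toℕ j N.<? toℕ i
... | yes _ = x
... | no  _ = y

InT3 : (ℓ : ℕ) → Mat 3 ℓ ℓ → Set
InT3 ℓ G = Σ (Fin 3) λ x → Σ (Fin 3) λ y → x ≢ y × (G ≐ Imat ℓ x y ⊎ G ≐ Tmat ℓ x y)

-- G ∈ T_ℓ(2), viewing 2-matrices as 3-matrices via the inclusion {0,1} ⊆ {0,1,2}.
InT2 : (ℓ : ℕ) → Mat 3 ℓ ℓ → Set
InT2 ℓ G = Σ (Fin 2) λ x → Σ (Fin 2) λ y → x ≢ y ×
  (G ≐ Imat ℓ (inject₁ x) (inject₁ y) ⊎ G ≐ Tmat ℓ (inject₁ x) (inject₁ y))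

M01 : Mat 3 1 2
M01 _ j = inject₁ j

data Fam (ℓ : ℕ) : Family 3 where
  diff  : (G : Mat 3 ℓ ℓ) → InT3 ℓ G → ¬ InT2 ℓ G → Fam ℓ ℓ ℓ G
  row01 : Fam ℓ 1 2 M01

ForbAtMost : (m r : ℕ) → Family r → ℕ → Set
ForbAtMost m r F C = ∀ (n : ℕ) (A : Mat r m n) → Simple A → Avoids F A → n ≤ C

ForbAtLeast : (m r : ℕ) → Family r → ℕ → Set
ForbAtLeast m r F c = Σ ℕ λ n → Σ (Mat r m n) λ A → Simple A × Avoids F A × c ≤ n

module Submission where

-- Lower bound: a single zero column avoids the family, since a member of
-- T_ℓ(3) with all entries 0 already lies in T_ℓ(2).
--
-- Upper bound. Avoiding [0 1] means that in every row the entries other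
-- than 2 carry one common plain symbol, so a row is described by its
-- 2-pattern (which entries are 2) and that symbol; in a simple matrix
-- distinct columns therefore have distinct 2-patterns. Among 2^L columns
-- with distinct Boolean patterns one finds a staircase of length L (rows
-- r₁ … r_L, columns c₁ … c_L with r_s taking a fixed bit b_s on c_t for
-- s < t and the other bit on c_s). Two pigeonhole steps (bit, symbol) and
-- Ramsey's theorem (on the entries below the diagonal) leave ℓ steps whose
-- submatrix is I_ℓ(·,·) or, read backwards, T_ℓ(·,·), with symbols 2 and a
-- plain symbol: a forbidden configuration once ℓ ≥ 2. For ℓ = 1 the
-- forbidden [2] leaves only constant rows, hence a single column.

open import Defs
open import Data.Bool using (Bool; true; false; not)
import Data.Bool as Bool
open import Data.Nat using (ℕ; zero; suc; _+_; _^_; _≤_; _<_; _≤?_; z≤n; s≤s)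
import Data.Nat as ℕ
open import Data.Nat.Properties
  using (+-suc; +-identityʳ; +-cancelˡ-≤; +-monoˡ-≤; *-monoʳ-≤; ≰⇒>; <⇒≤; ≤-trans; ≤-refl;
         <-irrefl; ∸-monoʳ-<; m^n>0; module ≤-Reasoning)
open import Data.Fin using (Fin; toℕ; inject₁; inject≤; fromℕ<; opposite; _≟_)
  renaming (zero to f0; suc to fs)
open import Data.Fin.Properties using (<-cmp; toℕ<n; opposite-prop; toℕ-inject≤; ¬∀⟶∃¬)
open import Data.List using (List; []; _∷_; length; filter; lookup; allFin)
open import Data.List.Properties using (length-tabulate)
open import Data.List.Membership.Propositional using (_∈_)
open import Data.List.Membership.Propositional.Properties using (∈-filter⁻)
open import Data.List.Relation.Unary.Any using (here; there)
open import Data.List.Relation.Unary.All using (All; []; _∷_)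
import Data.List.Relation.Unary.All as All
import Data.List.Relation.Unary.All.Properties as All
open import Data.List.Relation.Unary.AllPairs using (AllPairs; []; _∷_)
import Data.List.Relation.Unary.AllPairs as AllPairs
import Data.List.Relation.Unary.AllPairs.Properties as AllPairs
open import Data.List.Relation.Unary.Unique.Propositional.Properties using (allFin⁺)
open import Data.List.Relation.Binary.Sublist.Propositional
  using (_⊆_; []; _∷_; _∷ʳ_; minimum; ⊆-trans)
open import Data.List.Relation.Binary.Sublist.Propositional.Properties
  using (filter-⊆; All-resp-⊆)
open import Data.Product using (Σ; _×_; _,_; proj₁; proj₂)
open import Data.Sum using (_⊎_; inj₁; inj₂; swap)
open import Data.Empty using (⊥; ⊥-elim)
open import Function using (_∘_)
open import Function.Definitions using (Injective)
open import Relation.Binary using (tri<; tri≈; tri>)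
open import Relation.Binary.PropositionalEquality
  using (_≡_; _≢_; refl; sym; trans; cong; subst; subst₂; module ≡-Reasoning)
open import Relation.Nullary using (¬_; yes; no)

-- Upper bounds R(p,q) for the two-colour Ramsey numbers.
ramseyBound : ℕ → ℕ → ℕ
ramseyBound zero    q       = 0
ramseyBound (suc p) zero    = 0
ramseyBound (suc p) (suc q) = suc (ramseyBound p (suc q) + ramseyBound (suc p) q)

-- Pigeonhole and Ramsey's theorem for colourings of list elements and of
-- ordered pairs of list elements.
module _ {X : Set} where

  select : (X → Bool) → Bool → List X → List X
  select f b = filter (λ x → f x Bool.≟ b)

  select-sizes : (f : X → Bool) (xs : List X) →
    length (select f false xs) + length (select f true xs) ≡ length xs
  select-sizes f [] = refl
  select-sizes f (x ∷ xs) with f x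
  ... | false = cong suc (select-sizes f xs)
  ... | true  = trans (+-suc _ _) (cong suc (select-sizes f xs))

  select-split : (f : X → Bool) (c d : ℕ) (xs : List X) → c + d ≤ length xs →
    c ≤ length (select f false xs) ⊎ d ≤ length (select f true xs)
  select-split f c d xs c+d≤ with c ≤? length (select f false xs)
  ... | yes c≤ = inj₁ c≤
  ... | no  c≰ = inj₂ (+-cancelˡ-≤ c _ _ (begin
      c + d                                               ≤⟨ c+d≤ ⟩
      length xs                                           ≡⟨ sym (select-sizes f xs) ⟩
      length (select f false xs) + length (select f true xs)
        ≤⟨ +-monoˡ-≤ _ (<⇒≤ (≰⇒> c≰)) ⟩
      c + length (select f true xs)                       ∎))
    where open ≤-Reasoning

  pigeonhole : (f : X → Bool) (k : ℕ) (xs : List X) → k + k ≤ length xs →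
    Σ Bool λ b → k ≤ length (select f b xs)
  pigeonhole f k xs h with select-split f k k xs h
  ... | inj₁ k≤ = false , k≤
  ... | inj₂ k≤ = true , k≤

  AllPairs-resp-⊆ : ∀ {R : X → X → Set} {xs ys : List X} → ys ⊆ xs → AllPairs R xs → AllPairs R ys
  AllPairs-resp-⊆ []           []       = []
  AllPairs-resp-⊆ (_ ∷ʳ ys⊆xs) (_ ∷ rs) = AllPairs-resp-⊆ ys⊆xs rs
  AllPairs-resp-⊆ (refl ∷ ys⊆xs) (r ∷ rs) = All-resp-⊆ ys⊆xs r ∷ AllPairs-resp-⊆ ys⊆xs rs

  record Clique (g : X → X → Bool) (c : Bool) (k : ℕ) (xs : List X) : Set where
    constructor clique
    field
      members : List X
      within  : members ⊆ xs
      mono    : AllPairs (λ a b → g a b ≡ c) members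
      large   : k ≤ length members

  module _ (g : X → X → Bool) {c : Bool} {k : ℕ} (v : X) (rest : List X) where

    extend : Clique g c k (select (g v) c rest) → Clique g c (suc k) (v ∷ rest)
    extend (clique ms sub mono large) =
      clique (v ∷ ms) (refl ∷ ⊆-trans sub (filter-⊆ _ rest))
             (All-resp-⊆ sub (All.all-filter _ rest) ∷ mono) (s≤s large)

    skip : ∀ {b} → Clique g c k (select (g v) b rest) → Clique g c k (v ∷ rest)
    skip (clique ms sub mono large) = clique ms (v ∷ʳ ⊆-trans sub (filter-⊆ _ rest)) mono large

  ramsey : (g : X → X → Bool) (p q : ℕ) (xs : List X) → ramseyBound p q ≤ length xs →
    Clique g false p xs ⊎ Clique g true q xs
  ramsey g zero    q       xs _ = inj₁ (clique [] (minimum xs) [] z≤n)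
  ramsey g (suc p) zero    xs _ = inj₂ (clique [] (minimum xs) [] z≤n)
  ramsey g (suc p) (suc q) (v ∷ rest) (s≤s h)
    with select-split (g v) (ramseyBound p (suc q)) (ramseyBound (suc p) q) rest h
  ... | inj₁ h₀ with ramsey g p (suc q) (select (g v) false rest) h₀
  ...   | inj₁ cl = inj₁ (extend g v rest cl)
  ...   | inj₂ cl = inj₂ (skip g v rest cl)
  ramsey g (suc p) (suc q) (v ∷ rest) (s≤s h)
      | inj₂ h₁ with ramsey g (suc p) q (select (g v) true rest) h₁
  ...   | inj₁ cl = inj₁ (skip g v rest cl)
  ...   | inj₂ cl = inj₂ (extend g v rest cl)

  ramsey-diagonal : (g : X → X → Bool) (p : ℕ) (xs : List X) → ramseyBound p p ≤ length xs →
    Σ Bool λ c → Clique g c p xs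
  ramsey-diagonal g p xs h with ramsey g p p xs h
  ... | inj₁ cl = false , cl
  ... | inj₂ cl = true , cl

  All-lookup : ∀ {P : X → Set} {xs : List X} → All P xs → (i : Fin (length xs)) → P (lookup xs i)
  All-lookup (px ∷ _)   f0     = px
  All-lookup (_  ∷ pxs) (fs i) = All-lookup pxs i

  AllPairs-lookup : ∀ {R : X → X → Set} {xs : List X} → AllPairs R xs →
    (i j : Fin (length xs)) → toℕ i < toℕ j → R (lookup xs i) (lookup xs j)
  AllPairs-lookup (r ∷ _)  f0     (fs j) _       = All-lookup r j
  AllPairs-lookup (_ ∷ rs) (fs i) (fs j) (s≤s h) = AllPairs-lookup rs i j h

bothValues : ∀ {u v : Bool} → u ≢ v → (b : Bool) → (u ≡ not b × v ≡ b) ⊎ (u ≡ b × v ≡ not b)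
bothValues {true}  {true}  u≢v _     = ⊥-elim (u≢v refl)
bothValues {false} {false} u≢v _     = ⊥-elim (u≢v refl)
bothValues {true}  {false} _   true  = inj₂ (refl , refl)
bothValues {true}  {false} _   false = inj₁ (refl , refl)
bothValues {false} {true}  _   true  = inj₁ (refl , refl)
bothValues {false} {true}  _   false = inj₂ (refl , refl)

sameOrOpposite : ∀ b c → c ≡ b ⊎ c ≡ not b
sameOrOpposite true  true  = inj₁ refl
sameOrOpposite false false = inj₁ refl
sameOrOpposite true  false = inj₂ refl
sameOrOpposite false true  = inj₂ refl

-- 2^(L+1) columns contain at least two, so a separating row exists.
2≤2^suc : ∀ L → 2 ≤ 2 ^ suc L
2≤2^suc L = *-monoʳ-≤ 2 (m^n>0 2 L)

module Staircases {m n : ℕ} (B : Fin m → Fin n → Bool) where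

  Separated : Fin n → Fin n → Set
  Separated c c' = Σ (Fin m) λ r → B r c ≢ B r c'

  record Step : Set where
    constructor step
    field
      row      : Fin m
      col      : Fin n
      other    : Fin n
      bit      : Bool
      diagonal : B row col ≡ not bit
      offside  : B row other ≡ bit
  open Step public

  Above : Step → Step → Set
  Above s t = B (row s) (col t) ≡ bit s

  record Staircase (L : ℕ) (xs : List (Fin n)) : Set where
    constructor staircase
    field
      steps       : List Step
      long        : L ≤ length steps
      ordered     : AllPairs Above steps
      fromColumns : All (λ s → col s ∈ xs) steps

  -- Any 2^L pairwise separated columns carry a staircase of length L: a row
  -- separating two of the columns splits them into two classes; the larger
  -- class carries a staircase of length L - 1, which that row extends.
  findStaircase : ∀ L (xs : List (Fin n)) → AllPairs Separated xs → 2 ^ L ≤ length xs →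
    Staircase L xs
  findStaircase zero xs _ _ = staircase [] z≤n [] []
  findStaircase (suc L) [] _ h with ≤-trans (2≤2^suc L) h
  ... | ()
  findStaircase (suc L) (c ∷ []) _ h with ≤-trans (2≤2^suc L) h
  ... | s≤s ()
  findStaircase (suc L) xs@(c ∷ c' ∷ rest) sep@(((r , c≁c') ∷ _) ∷ _) h
    with pigeonhole (B r) (2 ^ L) xs
           (subst (_≤ length xs) (cong (2 ^ L +_) (+-identityʳ (2 ^ L))) h)
  ... | b , hb = extendBy (bothValues c≁c' b)
    where
    rec : Staircase L (select (B r) b xs)
    rec = findStaircase L (select (B r) b xs) (AllPairs.filter⁺ (λ d → B r d Bool.≟ b) sep) hb
    open Staircase rec

    sameClass : All (λ s → col s ∈ xs × B r (col s) ≡ b) steps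
    sameClass = All.map (∈-filter⁻ (λ d → B r d Bool.≟ b)) fromColumns

    withStep : ∀ p w → p ∈ xs → B r p ≡ not b → B r w ≡ b → Staircase (suc L) xs
    withStep p w p∈xs diag off =
      staircase (step r p w b diag off ∷ steps) (s≤s long)
                (All.map proj₂ sameClass ∷ ordered) (p∈xs ∷ All.map proj₁ sameClass)

    extendBy : (B r c ≡ not b × B r c' ≡ b) ⊎ (B r c ≡ b × B r c' ≡ not b) → Staircase (suc L) xs
    extendBy (inj₁ (diag , off)) = withStep c c' (here refl) diag off
    extendBy (inj₂ (off , diag)) = withStep c' c (there (here refl)) diag off

module _ {r : ℕ} {ℓ : ℕ} {x y : Fin r} where

  Imat-diagonal : ∀ i → Imat ℓ x y i i ≡ x
  Imat-diagonal i with i ≟ i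
  ... | yes _  = refl
  ... | no i≢i = ⊥-elim (i≢i refl)

  Imat-off : ∀ i j → i ≢ j → Imat ℓ x y i j ≡ y
  Imat-off i j i≢j with i ≟ j
  ... | yes i≡j = ⊥-elim (i≢j i≡j)
  ... | no _    = refl

  Tmat-below : ∀ i j → toℕ j < toℕ i → Tmat ℓ x y i j ≡ x
  Tmat-below i j j<i with toℕ j ℕ.<? toℕ i
  ... | yes _   = refl
  ... | no j≮i  = ⊥-elim (j≮i j<i)

  Tmat-upper : ∀ i j → ¬ (toℕ j < toℕ i) → Tmat ℓ x y i j ≡ y
  Tmat-upper i j j≮i with toℕ j ℕ.<? toℕ i
  ... | yes j<i = ⊥-elim (j≮i j<i)
  ... | no _    = refl

Imat-rename : ∀ {r s ℓ} (f : Fin r → Fin s) (x y : Fin r) i j →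
  Imat ℓ (f x) (f y) i j ≡ f (Imat ℓ x y i j)
Imat-rename f x y i j with i ≟ j
... | yes _ = refl
... | no  _ = refl

Tmat-rename : ∀ {r s ℓ} (f : Fin r → Fin s) (x y : Fin r) i j →
  Tmat ℓ (f x) (f y) i j ≡ f (Tmat ℓ x y i j)
Tmat-rename f x y i j with toℕ j ℕ.<? toℕ i
... | yes _ = refl
... | no  _ = refl

injective-from-< : ∀ {ℓ} {Y : Set} (f : Fin ℓ → Y) →
  (∀ i j → toℕ i < toℕ j → f i ≢ f j) → Injective _≡_ _≡_ f
injective-from-< f separates {i} {j} fi≡fj with <-cmp i j
... | tri< i<j _ _ = ⊥-elim (separates i j i<j fi≡fj)
... | tri≈ _ i≡j _ = i≡j
... | tri> _ _ j<i = ⊥-elim (separates j i j<i (sym fi≡fj))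

<⇒≢ : ∀ {ℓ} {i j : Fin ℓ} → toℕ i < toℕ j → i ≢ j
<⇒≢ i<j refl = <-irrefl refl i<j

-- A cellwise match of I_ℓ(x,y) or T_ℓ(x,y) (x ≢ y) in A is an occurrence:
-- the row and column maps are forced to be injective.
module _ {r m n ℓ : ℕ} (A : Mat r m n) {x y : Fin r} (x≢y : x ≢ y)
         (σ : Fin ℓ → Fin m) (τ : Fin ℓ → Fin n) where

  open ≡-Reasoning

  embed-I : (∀ i j → Imat ℓ x y i j ≡ A (σ i) (τ j)) → Imat ℓ x y ≺ A
  embed-I match = σ , τ , injective-from-< σ rowsDiffer , injective-from-< τ colsDiffer , match
    where
    rowsDiffer : ∀ i j → toℕ i < toℕ j → σ i ≢ σ j
    rowsDiffer i j i<j σi≡σj = x≢y (begin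
      x                   ≡⟨ sym (Imat-diagonal i) ⟩
      Imat ℓ x y i i      ≡⟨ match i i ⟩
      A (σ i) (τ i)       ≡⟨ cong (λ ρ → A ρ (τ i)) σi≡σj ⟩
      A (σ j) (τ i)       ≡⟨ sym (match j i) ⟩
      Imat ℓ x y j i      ≡⟨ Imat-off j i (λ j≡i → <⇒≢ i<j (sym j≡i)) ⟩
      y                   ∎)
    colsDiffer : ∀ i j → toℕ i < toℕ j → τ i ≢ τ j
    colsDiffer i j i<j τi≡τj = x≢y (begin
      x                   ≡⟨ sym (Imat-diagonal i) ⟩
      Imat ℓ x y i i      ≡⟨ match i i ⟩
      A (σ i) (τ i)       ≡⟨ cong (A (σ i)) τi≡τj ⟩
      A (σ i) (τ j)       ≡⟨ sym (match i j) ⟩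
      Imat ℓ x y i j      ≡⟨ Imat-off i j (<⇒≢ i<j) ⟩
      y                   ∎)

  embed-T : (∀ i j → Tmat ℓ x y i j ≡ A (σ i) (τ j)) → Tmat ℓ x y ≺ A
  embed-T match = σ , τ , injective-from-< σ rowsDiffer , injective-from-< τ colsDiffer , match
    where
    rowsDiffer : ∀ i j → toℕ i < toℕ j → σ i ≢ σ j
    rowsDiffer i j i<j σi≡σj = x≢y (begin
      x                   ≡⟨ sym (Tmat-below j i i<j) ⟩
      Tmat ℓ x y j i      ≡⟨ match j i ⟩
      A (σ j) (τ i)       ≡⟨ cong (λ ρ → A ρ (τ i)) (sym σi≡σj) ⟩
      A (σ i) (τ i)       ≡⟨ sym (match i i) ⟩
      Tmat ℓ x y i i      ≡⟨ Tmat-upper i i (<-irrefl refl) ⟩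
      y                   ∎)
    colsDiffer : ∀ i j → toℕ i < toℕ j → τ i ≢ τ j
    colsDiffer i j i<j τi≡τj = x≢y (begin
      x                   ≡⟨ sym (Tmat-below j i i<j) ⟩
      Tmat ℓ x y j i      ≡⟨ match j i ⟩
      A (σ j) (τ i)       ≡⟨ cong (A (σ j)) τi≡τj ⟩
      A (σ j) (τ j)       ≡⟨ sym (match j j) ⟩
      Tmat ℓ x y j j      ≡⟨ Tmat-upper j j (<-irrefl refl) ⟩
      y                   ∎)

record Ordered {X : Set} {ℓ : ℕ} (M : Fin ℓ → Fin ℓ → X) (above diag below : X) : Set where
  field
    aboveDiagonal : ∀ i j → toℕ i < toℕ j → M i j ≡ above
    onDiagonal    : ∀ i → M i i ≡ diag
    belowDiagonal : ∀ i j → toℕ j < toℕ i → M i j ≡ below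

open Ordered public

module _ {r ℓ : ℕ} {M : Mat r ℓ ℓ} where

  ordered-I : ∀ {u d} → Ordered M u d u → M ≐ Imat ℓ d u
  ordered-I ord i j with <-cmp i j
  ... | tri< i<j _ _  = trans (aboveDiagonal ord i j i<j) (sym (Imat-off i j (<⇒≢ i<j)))
  ... | tri≈ _ refl _ = trans (onDiagonal ord i) (sym (Imat-diagonal i))
  ... | tri> _ _ j<i  = trans (belowDiagonal ord i j j<i)
                              (sym (Imat-off i j (λ i≡j → <⇒≢ j<i (sym i≡j))))

  ordered-T : ∀ {d w} → Ordered M d d w → M ≐ Tmat ℓ w d
  ordered-T ord i j with <-cmp i j
  ... | tri< i<j _ j≯i = trans (aboveDiagonal ord i j i<j) (sym (Tmat-upper i j j≯i))
  ... | tri≈ _ refl _  = trans (onDiagonal ord i) (sym (Tmat-upper i i (<-irrefl refl)))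
  ... | tri> _ _ j<i   = trans (belowDiagonal ord i j j<i) (sym (Tmat-below i j j<i))

opposite-reverses : ∀ {ℓ} {i j : Fin ℓ} → toℕ i < toℕ j → toℕ (opposite j) < toℕ (opposite i)
opposite-reverses {ℓ} {i} {j} i<j rewrite opposite-prop i | opposite-prop j =
  ∸-monoʳ-< (s≤s i<j) (toℕ<n j)

reverse-ordered : ∀ {X : Set} {ℓ} {M : Fin ℓ → Fin ℓ → X} {u d w : X} → Ordered M u d w →
  Ordered (λ i j → M (opposite i) (opposite j)) w d u
reverse-ordered ord = record
  { aboveDiagonal = λ i j i<j → belowDiagonal ord _ _ (opposite-reverses i<j)
  ; onDiagonal    = λ i → onDiagonal ord (opposite i)
  ; belowDiagonal = λ i j j<i → aboveDiagonal ord _ _ (opposite-reverses j<i)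
  }

-- The symbol 2, the one that T_ℓ(3) \ T_ℓ(2) adds to T_ℓ(2).
two : Fin 3
two = fs (fs f0)

ContainsTwo : ∀ {k l} → Mat 3 k l → Set
ContainsTwo {k} {l} G = Σ (Fin k) λ i → Σ (Fin l) λ j → G i j ≡ two

inject₁≢two : ∀ (z : Fin 2) → inject₁ z ≢ two
inject₁≢two f0      ()
inject₁≢two (fs f0) ()

T2-twoFree : ∀ {ℓ} {G : Mat 3 ℓ ℓ} → InT2 ℓ G → ¬ ContainsTwo G
T2-twoFree {ℓ} (x , y , _ , inj₁ G≐I) (i , j , Gij≡2) =
  inject₁≢two (Imat ℓ x y i j)
    (trans (sym (Imat-rename inject₁ x y i j)) (trans (sym (G≐I i j)) Gij≡2))
T2-twoFree {ℓ} (x , y , _ , inj₂ G≐T) (i , j , Gij≡2) =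
  inject₁≢two (Tmat ℓ x y i j)
    (trans (sym (Tmat-rename inject₁ x y i j)) (trans (sym (G≐T i j)) Gij≡2))

forbidden : ∀ {ℓ} {G : Mat 3 ℓ ℓ} → InT3 ℓ G → ContainsTwo G → Fam ℓ ℓ ℓ G
forbidden {G = G} inT3 hasTwo = diff G inT3 (λ inT2 → T2-twoFree inT2 hasTwo)

I-containsTwo : ∀ k {x y : Fin 3} → x ≡ two ⊎ y ≡ two → ContainsTwo (Imat (suc (suc k)) x y)
I-containsTwo k (inj₁ x≡2) = f0 , f0 , x≡2
I-containsTwo k (inj₂ y≡2) = f0 , fs f0 , y≡2

T-containsTwo : ∀ k {x y : Fin 3} → x ≡ two ⊎ y ≡ two → ContainsTwo (Tmat (suc (suc k)) x y)
T-containsTwo k (inj₁ x≡2) = fs f0 , f0 , x≡2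
T-containsTwo k (inj₂ y≡2) = f0 , f0 , y≡2

-- Cells of a [0 1]-free 3-matrix: a row's entries other than 2 share one
-- plain symbol x, so each entry is cell x (whether it is 2).
isTwo : Fin 3 → Bool
isTwo f0           = false
isTwo (fs f0)      = false
isTwo (fs (fs f0)) = true

isTwo-true : ∀ v → isTwo v ≡ true → v ≡ two
isTwo-true (fs (fs f0)) _ = refl

isTwo-false : ∀ v → isTwo v ≡ false → v ≢ two
isTwo-false (fs (fs f0)) () refl

cell : Fin 3 → Bool → Fin 3
cell x true  = two
cell x false = x

cell-distinct : ∀ {x} → x ≢ two → ∀ b → cell x b ≢ cell x (not b)
cell-distinct x≢2 true  2≡x = x≢2 (sym 2≡x)
cell-distinct x≢2 false x≡2 = x≢2 x≡2

cell-two : ∀ x b → cell x b ≡ two ⊎ cell x (not b) ≡ two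
cell-two x true  = inj₁ refl
cell-two x false = inj₂ refl

plain-equal : ∀ u v → isTwo u ≡ false → isTwo v ≡ false →
  (u ≡ f0 → v ≡ fs f0 → ⊥) → (v ≡ f0 → u ≡ fs f0 → ⊥) → u ≡ v
plain-equal f0           f0           _  _  _   _   = refl
plain-equal (fs f0)      (fs f0)      _  _  _   _   = refl
plain-equal f0           (fs f0)      _  _  u0v1 _  = ⊥-elim (u0v1 refl refl)
plain-equal (fs f0)      f0           _  _  _   v0u1 = ⊥-elim (v0u1 refl refl)
plain-equal (fs (fs f0)) _            () _  _   _
plain-equal f0           (fs (fs f0)) _  () _   _
plain-equal (fs f0)      (fs (fs f0)) _  () _   _

module ZeroOneFree {m n : ℕ} (A : Mat 3 m n) (avoids01 : ¬ (M01 ≺ A)) where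

  twos : Fin m → Fin n → Bool
  twos r c = isTwo (A r c)

  noZeroOne : ∀ r c c' → A r c ≡ f0 → A r c' ≡ fs f0 → ⊥
  noZeroOne r c c' Arc≡0 Arc'≡1 =
    avoids01 (σ , τ , injective-from-< σ oneRow , injective-from-< τ twoCols , match)
    where
    σ : Fin 1 → Fin m
    σ _ = r
    τ : Fin 2 → Fin n
    τ f0      = c
    τ (fs f0) = c'
    oneRow : ∀ i j → toℕ i < toℕ j → σ i ≢ σ j
    oneRow f0 f0 ()
    twoCols : ∀ i j → toℕ i < toℕ j → τ i ≢ τ j
    twoCols f0 (fs f0) _ refl with trans (sym Arc≡0) Arc'≡1
    ... | ()
    twoCols (fs f0) (fs f0) (s≤s ())
    match : ∀ i j → M01 i j ≡ A (σ i) (τ j)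
    match f0 f0      = sym Arc≡0
    match f0 (fs f0) = sym Arc'≡1

  plainConstant : ∀ r c c' → twos r c ≡ false → twos r c' ≡ false → A r c ≡ A r c'
  plainConstant r c c' plain plain' =
    plain-equal (A r c) (A r c') plain plain' (noZeroOne r c c') (noZeroOne r c' c)

  cellValue : ∀ r w c → twos r w ≡ false → A r c ≡ cell (A r w) (twos r c)
  cellValue r w c plain-w with twos r c in e
  ... | true  = isTwo-true (A r c) e
  ... | false = plainConstant r c w e plain-w

  separated : Simple A → ∀ {c c'} → c ≢ c' → Staircases.Separated twos c c'
  separated simple {c} {c'} c≢c'
    with ¬∀⟶∃¬ m (λ r → A r c ≡ A r c') (λ r → A r c ≟ A r c') (c≢c' ∘ simple c c')
  ... | r , Arc≢Arc' = r , differ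
    where
    differ : twos r c ≢ twos r c'
    differ same with twos r c in e
    ... | true  = Arc≢Arc' (trans (isTwo-true _ e) (sym (isTwo-true _ (sym same))))
    ... | false = Arc≢Arc' (plainConstant r c c' e (sym same))

-- Classifying plain symbols by one bit, used to pigeonhole on row symbols.
isZero : Fin 3 → Bool
isZero f0     = true
isZero (fs _) = false

plainSymbol : Bool → Fin 3
plainSymbol true  = f0
plainSymbol false = fs f0

plainSymbol-isZero : ∀ v → v ≢ two → v ≡ plainSymbol (isZero v)
plainSymbol-isZero f0           _   = refl
plainSymbol-isZero (fs f0)      _   = refl
plainSymbol-isZero (fs (fs f0)) v≢2 = ⊥-elim (v≢2 refl)

plainSymbol≢two : ∀ e → plainSymbol e ≢ two
plainSymbol≢two true  ()
plainSymbol≢two false ()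

columnLimit : ℕ → ℕ
columnLimit ℓ = let K = ramseyBound ℓ ℓ in 2 ^ ((K + K) + (K + K))

module UpperBound (k : ℕ) {m n : ℕ} (A : Mat 3 m n) (simple : Simple A)
                  (avoids : Avoids (Fam (suc (suc k))) A) where

  ℓ : ℕ
  ℓ = suc (suc k)

  open ZeroOneFree A (avoids 1 2 M01 row01)
  open Staircases twos

  -- Each staircase row takes both 2-pattern values, so it has a plain entry,
  -- whose symbol is the plain symbol of the row.
  plainColumn : (s : Step) → Σ (Fin n) λ w → twos (row s) w ≡ false
  plainColumn s with bit s | diagonal s | offside s
  ... | true  | onCol | _       = col s , onCol
  ... | false | _     | onOther = other s , onOther

  symbol : Step → Fin 3
  symbol s = A (row s) (proj₁ (plainColumn s))

  symbol≢two : ∀ s → symbol s ≢ two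
  symbol≢two s = isTwo-false _ (proj₂ (plainColumn s))

  belowColour : Step → Step → Bool
  belowColour s t = twos (row t) (col s)

  record Uniform : Set where
    field
      b cc     : Bool
      x        : Fin 3
      x≢two    : x ≢ two
      ys       : List Step
      above    : AllPairs Above ys
      uniform  : All (λ s → bit s ≡ b × symbol s ≡ x) ys
      belowCc  : AllPairs (λ s t → belowColour s t ≡ cc) ys
      long     : ℓ ≤ length ys

  K : ℕ
  K = ramseyBound ℓ ℓ

  -- Two pigeonhole steps (bit, symbol) and Ramsey's theorem (below colour)
  -- make a staircase of length 4K uniform.
  uniformize : (ps : List Step) → AllPairs Above ps → (K + K) + (K + K) ≤ length ps → Uniform
  uniformize ps above long
    with pigeonhole bit (K + K) ps long
  ... | b , hb with pigeonhole (isZero ∘ symbol) K (select bit b ps) hb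
  ... | e , he with ramsey-diagonal belowColour ℓ (select (isZero ∘ symbol) e (select bit b ps)) he
  ... | cc , clique ys ys⊆ mono large = record
    { b = b ; cc = cc ; x = plainSymbol e ; x≢two = plainSymbol≢two e ; ys = ys
    ; above   = AllPairs-resp-⊆ (⊆-trans ys⊆ (⊆-trans (filter-⊆ _ _) (filter-⊆ _ _))) above
    ; uniform = All-resp-⊆ ys⊆ (All.map symbolIs sameBitAndSymbol)
    ; belowCc = mono
    ; long    = large
    }
    where
    sameBitAndSymbol : All (λ s → bit s ≡ b × isZero (symbol s) ≡ e)
                           (select (isZero ∘ symbol) e (select bit b ps))
    sameBitAndSymbol = All.zip
      ( All.filter⁺ (λ s → isZero (symbol s) Bool.≟ e) (All.all-filter (λ s → bit s Bool.≟ b) ps)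
      , All.all-filter _ (select bit b ps))
    symbolIs : ∀ {s} → bit s ≡ b × isZero (symbol s) ≡ e → bit s ≡ b × symbol s ≡ plainSymbol e
    symbolIs {s} (bs , zs) = bs , trans (plainSymbol-isZero _ (symbol≢two s)) (cong plainSymbol zs)

  -- A uniform staircase is an occurrence of a forbidden matrix: if the
  -- entries below and above the diagonal agree (cc = b) it is an
  -- I_ℓ-pattern; otherwise, read in reverse order, it is a T_ℓ-pattern.
  -- Either way both symbols 2 and x occur.
  noUniform : Uniform → ⊥
  noUniform u = conclude (sameOrOpposite b cc)
    where
    open Uniform u

    at : Fin ℓ → Step
    at i = lookup ys (inject≤ i long)

    before : ∀ {i j} → toℕ i < toℕ j → toℕ (inject≤ i long) < toℕ (inject≤ j long)
    before {i} {j} = subst₂ _<_ (sym (toℕ-inject≤ i long)) (sym (toℕ-inject≤ j long))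

    σ : Fin ℓ → Fin m
    σ i = row (at i)

    τ : Fin ℓ → Fin n
    τ j = col (at j)

    M : Mat 3 ℓ ℓ
    M i j = A (σ i) (τ j)

    entry : ∀ i j → M i j ≡ cell x (twos (σ i) (τ j))
    entry i j = trans (cellValue (σ i) _ (τ j) (proj₂ (plainColumn (at i))))
                      (cong (λ v → cell v (twos (σ i) (τ j))) (proj₂ (All-lookup uniform _)))

    shape : Ordered M (cell x b) (cell x (not b)) (cell x cc)
    shape = record
      { aboveDiagonal = λ i j i<j → trans (entry i j)
          (cong (cell x) (trans (AllPairs-lookup above _ _ (before i<j)) (proj₁ (All-lookup uniform _))))
      ; onDiagonal    = λ i → trans (entry i i)
          (cong (cell x) (trans (diagonal (at i)) (cong not (proj₁ (All-lookup uniform _)))))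
      ; belowDiagonal = λ i j j<i → trans (entry i j)
          (cong (cell x) (AllPairs-lookup belowCc _ _ (before j<i)))
      }

    distinct : cell x (not b) ≢ cell x b
    distinct = cell-distinct x≢two b ∘ sym

    conclude : cc ≡ b ⊎ cc ≡ not b → ⊥
    conclude (inj₁ cc≡b) = avoids ℓ ℓ _ member (embed-I A distinct σ τ match)
      where
      member : Fam ℓ ℓ ℓ (Imat ℓ (cell x (not b)) (cell x b))
      member = forbidden (_ , _ , distinct , inj₁ (λ _ _ → refl))
                         (I-containsTwo k (swap (cell-two x b)))
      match : ∀ i j → Imat ℓ (cell x (not b)) (cell x b) i j ≡ M i j
      match i j = sym (ordered-I (subst (Ordered M _ _ ∘ cell x) cc≡b shape) i j)
    conclude (inj₂ cc≡¬b) =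
      avoids ℓ ℓ _ member (embed-T A (distinct ∘ sym) (σ ∘ opposite) (τ ∘ opposite) match)
      where
      member : Fam ℓ ℓ ℓ (Tmat ℓ (cell x b) (cell x (not b)))
      member = forbidden (_ , _ , distinct ∘ sym , inj₂ (λ _ _ → refl))
                         (T-containsTwo k (cell-two x b))
      match : ∀ i j → Tmat ℓ (cell x b) (cell x (not b)) i j ≡ M (opposite i) (opposite j)
      match i j =
        sym (ordered-T (reverse-ordered (subst (Ordered M _ _ ∘ cell x) cc≡¬b shape)) i j)

  -- The columns carry a staircase of length 4K once there are 2^(4K) of them.
  columnBound : n ≤ columnLimit ℓ
  columnBound with n ≤? columnLimit ℓ
  ... | yes n≤ = n≤
  ... | no  n≰ = ⊥-elim (noUniform (uniformize steps ordered long))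
    where
    columnsSeparated : AllPairs Separated (allFin n)
    columnsSeparated = AllPairs.map (separated simple) (allFin⁺ n)
    enough : columnLimit ℓ ≤ length (allFin n)
    enough = subst (_ ≤_) (sym (length-tabulate (λ c → c))) (<⇒≤ (≰⇒> n≰))
    open Staircase (findStaircase ((K + K) + (K + K)) (allFin n) columnsSeparated enough)

atMostOneColumn : ∀ {r m n} (A : Mat r m n) → Simple A → (∀ c c' r → A r c ≡ A r c') → n ≤ 1
atMostOneColumn {n = zero}          A _      _     = z≤n
atMostOneColumn {n = suc zero}      A _      _     = s≤s z≤n
atMostOneColumn {n = suc (suc n)}   A simple equal with simple f0 (fs f0) (equal f0 (fs f0))
... | ()

-- For ℓ = 1 the family forbids the 1×1 matrix [2]; a [0 1]-free
-- matrix without entries 2 has constant rows, hence one column at most.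
upperBound-1 : ∀ {m n} (A : Mat 3 m n) → Simple A → Avoids (Fam 1) A → n ≤ 1
upperBound-1 A simple avoids =
  atMostOneColumn A simple (λ c c' r → plainConstant r c c' (noTwo r c) (noTwo r c'))
  where
  open ZeroOneFree A (avoids 1 2 M01 row01)
  noTwo : ∀ r c → twos r c ≡ false
  noTwo r c with twos r c in e
  ... | false = refl
  ... | true  = ⊥-elim (avoids 1 1 _
    (forbidden (two , f0 , (λ ()) , inj₁ (λ _ _ → refl)) (f0 , f0 , refl))
    (embed-I A (λ ()) (λ _ → r) (λ _ → c) (λ { f0 f0 → sym (isTwo-true _ e) })))

upperBound : ∀ ℓ → 1 ≤ ℓ → ∀ m → ForbAtMost m 3 (Fam ℓ) (columnLimit ℓ)
upperBound (suc zero)    _ m n A simple avoids = ≤-trans (upperBound-1 A simple avoids) (s≤s z≤n)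
upperBound (suc (suc k)) _ m n A simple avoids = UpperBound.columnBound k A simple avoids

-- A member of T_ℓ(3) all of whose entries are 0 lies in T_ℓ(2)
-- (for ℓ ≥ 2 no such member exists; for ℓ = 1 it is [0]).
zero-InT2 : ∀ {ℓ} {G : Mat 3 ℓ ℓ} → 1 ≤ ℓ → InT3 ℓ G → (∀ i j → G i j ≡ f0) → InT2 ℓ G
zero-InT2 {ℓ} {G} 1≤ℓ (x , y , x≢y , inj₁ G≐I) allZero =
  f0 , fs f0 , (λ ()) , inj₁ (ordered-I (record
    { aboveDiagonal = λ i j i<j → ⊥-elim (offDiagonal i j (<⇒≢ i<j))
    ; onDiagonal    = λ i → allZero i i
    ; belowDiagonal = λ i j j<i → ⊥-elim (offDiagonal i j (<⇒≢ j<i ∘ sym))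
    }))
  where
  open ≡-Reasoning
  i₀ : Fin ℓ
  i₀ = fromℕ< 1≤ℓ
  offDiagonal : ∀ i j → i ≢ j → ⊥
  offDiagonal i j i≢j = x≢y (begin
    x              ≡⟨ sym (Imat-diagonal i₀) ⟩
    Imat ℓ x y i₀ i₀ ≡⟨ sym (G≐I i₀ i₀) ⟩
    G i₀ i₀        ≡⟨ allZero i₀ i₀ ⟩
    f0             ≡⟨ sym (allZero i j) ⟩
    G i j          ≡⟨ G≐I i j ⟩
    Imat ℓ x y i j ≡⟨ Imat-off i j i≢j ⟩
    y              ∎)
zero-InT2 {ℓ} {G} 1≤ℓ (x , y , x≢y , inj₂ G≐T) allZero =
  fs f0 , f0 , (λ ()) , inj₂ (ordered-T (record
    { aboveDiagonal = λ i j _ → allZero i j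
    ; onDiagonal    = λ i → allZero i i
    ; belowDiagonal = λ i j j<i → ⊥-elim (strictlyBelow i j j<i)
    }))
  where
  open ≡-Reasoning
  i₀ : Fin ℓ
  i₀ = fromℕ< 1≤ℓ
  strictlyBelow : ∀ i j → toℕ j < toℕ i → ⊥
  strictlyBelow i j j<i = x≢y (begin
    x              ≡⟨ sym (Tmat-below i j j<i) ⟩
    Tmat ℓ x y i j ≡⟨ sym (G≐T i j) ⟩
    G i j          ≡⟨ allZero i j ⟩
    f0             ≡⟨ sym (allZero i₀ i₀) ⟩
    G i₀ i₀        ≡⟨ G≐T i₀ i₀ ⟩
    Tmat ℓ x y i₀ i₀ ≡⟨ Tmat-upper i₀ i₀ (<-irrefl refl) ⟩
    y              ∎)

zeroColumn : ∀ m → Mat 3 m 1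
zeroColumn m _ _ = f0

lowerBound : ∀ ℓ → 1 ≤ ℓ → ∀ m → ForbAtLeast m 3 (Fam ℓ) 1
lowerBound ℓ 1≤ℓ m = 1 , zeroColumn m , (λ { f0 f0 _ → refl }) , avoids , ≤-refl
  where
  avoids : Avoids (Fam ℓ) (zeroColumn m)
  avoids .1 .2 .M01 row01 (_ , _ , _ , _ , match) with match f0 (fs f0)
  ... | ()
  avoids .ℓ .ℓ G (diff .G inT3 notInT2) (_ , _ , _ , _ , match) =
    notInT2 (zero-InT2 1≤ℓ inT3 match)

mainTheorem9 : (ℓ : ℕ) → 1 ≤ ℓ →
    Σ ℕ λ c → Σ ℕ λ C → Σ ℕ λ M → 0 < c ×
      (∀ (m : ℕ) → M ≤ m → ForbAtLeast m 3 (Fam ℓ) c × ForbAtMost m 3 (Fam ℓ) C)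
mainTheorem9 ℓ 1≤ℓ =
  1 , columnLimit ℓ , 0 , s≤s z≤n , λ m _ → lowerBound ℓ 1≤ℓ m , upperBound ℓ 1≤ℓ m
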